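{- Let $m\ge2$ be an integer and $z>0$. Then the number of positive divisors $d$ of $m$ with $d\le z$ is at most $\Psi(z,q)$, where $q$ is the largest prime number with $$\prod_{\substack{\ell\le q\\ \ell\ \mathrm{prime}}}\ell\le m.$$
   Context: $\Psi(x,y)$ is the number of positive integers $n\le x$ all of whose prime factors are at most $y$. (In the paper this count is denoted $\tau(m,1,z)$: the number of integers $dl\le z$ with $d\mid m$ and $l$ a $1$-smooth number, i.e. $l=1$.) -}

module Defs where

open import Data.Nat using (ℕ; zero; suc; _*_; _≤_; _<_; _≤?_; s≤s)
open import Data.Nat.Properties using (allUpTo?)
open import Data.Nat.Divisibility using (_∣_; _∣?_; ∣⇒≤)
open import Data.Nat.Primality using (Prime; prime?)
open import Data.List using (List; length; filter; upTo)
open import Relation.Nullary using (Dec; yes; no; does)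
open import Relation.Nullary.Decidable using (map′; _→-dec_)
open import Data.Bool using (if_then_else_)

primorial : ℕ → ℕ
primorial zero = 1
primorial (suc n) = if does (prime? (suc n)) then suc n * primorial n else primorial n

Smooth : ℕ → ℕ → Set
Smooth y n = ∀ p → Prime p → p ∣ n → p ≤ y

smooth? : ∀ y n → Dec (Smooth y (suc n))
smooth? y n = map′ to from (allUpTo? (λ p → prime? p →-dec (p ∣? suc n →-dec p ≤? y)) (suc (suc n)))
  where
  to : (∀ {p} → p < suc (suc n) → Prime p → p ∣ suc n → p ≤ y) → Smooth y (suc n)
  to h p pp d = h (s≤s (∣⇒≤ d)) pp d
  from : Smooth y (suc n) → ∀ {p} → p < suc (suc n) → Prime p → p ∣ suc n → p ≤ y
  from h {p} _ pp d = h p pp d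

-- Ψ x y = #{ 1 ≤ n ≤ x : n is y-smooth }   (n = suc k, k < x)
Ψ : ℕ → ℕ → ℕ
Ψ x y = length (filter (λ k → smooth? y k) (upTo x))

-- number of positive divisors d of m with d ≤ z   (d = suc k, k < z)
divisorsUpTo : ℕ → ℕ → ℕ
divisorsUpTo m z = length (filter (λ k → suc k ∣? m) (upTo z))

{-# OPTIONS --safe #-}
-- Write m = p₁^a₁ ⋯ p_k^a_k with p₁ < ⋯ < p_k and let ℓ_i be the i-th prime, so ℓ_i ≤ p_i.
-- Replacing each p_i by ℓ_i maps the divisors of m injectively to ℓ_k-smooth numbers no larger
-- than themselves, and primorial ℓ_k = ℓ₁ ⋯ ℓ_k ≤ p₁ ⋯ p_k ≤ m forces ℓ_k ≤ q. The map is built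
-- by induction on a bound for the prime factors of m: the largest one, p_k, is sent to the least
-- prime ℓ_k above the bound already reached by the smaller ones.
module Submission where

open import Defs
open import Data.Nat using (ℕ; _≤_)
open import Data.Nat.Primality using (Prime)

open import Level using (Level)
open import Function using (_∘_)
open import Data.Nat.Base
  using (zero; suc; pred; _+_; _*_; _^_; _<_; s≤s; z≤n; NonZero; >-nonZero⁻¹; NonTrivial; nonTrivial⇒≢1)
open import Data.Nat.Properties
open import Data.Nat.Divisibility
  using (_∣_; _∣?_; divides; ∣-trans; m∣m*n; ∣⇒≤; 0∣⇒≡0; ∣1⇒≡1; quotient; quotient≢0; quotient-<; m∣n⇒n≡m*quotient)
open import Data.Nat.Coprimality using (Coprime; coprime-divisor)
open import Data.Nat.Primality using (prime?; prime⇒nonTrivial; prime⇒nonZero; prime⇒irreducible; euclidsLemma)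
open import Data.Nat.Induction using (<-wellFounded)
open import Data.List.Base using (List; _∷_; length; filter; upTo)
open import Data.List.Properties using (filter-notAll)
open import Data.List.Membership.Propositional using (_∈_)
open import Data.List.Membership.Propositional.Properties using (∈-filter⁺; ∈-filter⁻; ∈-upTo⁺; ∈-upTo⁻)
open import Data.List.Relation.Unary.Any using (here; there)
import Data.List.Relation.Unary.Any as Any
import Data.List.Relation.Unary.All as All
open import Data.List.Relation.Unary.AllPairs using ([]; _∷_)
open import Data.List.Relation.Unary.Unique.Propositional using (Unique)
open import Data.List.Relation.Unary.Unique.Propositional.Properties using (filter⁺; upTo⁺)
open import Data.Product using (∃-syntax; _×_; _,_; proj₁; proj₂)
open import Data.Sum using (_⊎_; inj₁; inj₂; [_,_]′)
open import Induction.WellFounded using (Acc; acc)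
open import Relation.Nullary using (¬_; ¬?; yes; no; contradiction)
open import Relation.Nullary.Decidable using (_×-dec_)
open import Relation.Unary using (Pred; Decidable)
open import Relation.Binary.Definitions using (DecidableEquality)
open import Relation.Binary.PropositionalEquality
  using (_≡_; refl; sym; trans; cong; subst; module ≡-Reasoning)

private
  variable
    ℓ : Level
    d l m n p r s y y′ : ℕ

length-≤-of-injection : {A B : Set} → DecidableEquality B → {xs : List A} {ys : List B} →
  Unique xs → (f : ∀ {x} → x ∈ xs → B) →
  (∀ {x x′} (x∈ : x ∈ xs) (x′∈ : x′ ∈ xs) → f x∈ ≡ f x′∈ → x ≡ x′) →
  (∀ {x} (x∈ : x ∈ xs) → f x∈ ∈ ys) →
  length xs ≤ length ys
length-≤-of-injection _≟_ [] f f-injective f-into = z≤n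
length-≤-of-injection _≟_ {_ ∷ xs} {ys} (x∉xs ∷ xs-unique) f f-injective f-into =
  ≤-trans (s≤s length-xs≤) (filter-notAll (λ b → ¬? (b ≟ fx)) ys fx∈ys)
  where
  fx = f (here refl)
  fx∈ys = Any.map (λ fx≡b b≢fx → b≢fx (sym fx≡b)) (f-into (here refl))
  length-xs≤ : length xs ≤ length (filter (λ b → ¬? (b ≟ fx)) ys)
  length-xs≤ = length-≤-of-injection _≟_ xs-unique (f ∘ there)
    (λ x∈ x′∈ → f-injective (there x∈) (there x′∈))
    (λ x′∈ → ∈-filter⁺ (λ b → ¬? (b ≟ fx)) (f-into (there x′∈))
      (λ fx′≡fx → All.lookup x∉xs x′∈ (sym (f-injective (there x′∈) (here refl) fx′≡fx))))

prime∣prime⇒≡ : Prime p → Prime l → p ∣ l → p ≡ l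
prime∣prime⇒≡ p-prime l-prime p∣l with prime⇒irreducible l-prime p∣l
... | inj₁ p≡1 = contradiction p≡1 (nonTrivial⇒≢1 {{prime⇒nonTrivial p-prime}})
... | inj₂ p≡l = p≡l

prime∣^⇒prime∣ : Prime p → ∀ n → p ∣ l ^ n → p ∣ l
prime∣^⇒prime∣ p-prime zero p∣1 = contradiction (∣1⇒≡1 p∣1) (nonTrivial⇒≢1 {{prime⇒nonTrivial p-prime}})
prime∣^⇒prime∣ {l = l} p-prime (suc n) p∣l^1+n with euclidsLemma l (l ^ n) p-prime p∣l^1+n
... | inj₁ p∣l = p∣l
... | inj₂ p∣l^n = prime∣^⇒prime∣ p-prime n p∣l^n

prime∤⇒coprime : Prime p → ¬ p ∣ s → Coprime s p
prime∤⇒coprime p-prime p∤s (c∣s , c∣p) with prime⇒irreducible p-prime c∣p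
... | inj₁ c≡1 = c≡1
... | inj₂ refl = contradiction c∣s p∤s

∣p^n*r⇒∣r : Prime p → ¬ p ∣ s → ∀ n → s ∣ p ^ n * r → s ∣ r
∣p^n*r⇒∣r {r = r} p-prime p∤s zero s∣r = subst (_ ∣_) (*-identityˡ r) s∣r
∣p^n*r⇒∣r {p} {s} {r} p-prime p∤s (suc n) s∣p^1+n*r =
  ∣p^n*r⇒∣r p-prime p∤s n (coprime-divisor (prime∤⇒coprime p-prime p∤s) (subst (s ∣_) (*-assoc p (p ^ n) r) s∣p^1+n*r))

divisor-nonZero : .{{NonZero n}} → d ∣ n → NonZero d
divisor-nonZero {suc _} {zero} 0∣n with () ← 0∣⇒≡0 0∣n
divisor-nonZero {d = suc _} _ = _

record PowerSplit (p d : ℕ) : Set where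
  constructor split
  field
    exponent cofactor : ℕ
    d≡p^e*c : d ≡ p ^ exponent * cofactor
    p∤cofactor : ¬ p ∣ cofactor

powerSplit-acc : ∀ p .{{_ : NonTrivial p}} d .{{_ : NonZero d}} → Acc _<_ d → PowerSplit p d
powerSplit-acc p d (acc rs) with p ∣? d
... | no p∤d = split 0 d (sym (*-identityˡ d)) p∤d
... | yes p∣d with powerSplit-acc p (quotient p∣d) {{quotient≢0 p∣d}} (rs (quotient-< p∣d))
...   | split e c q≡p^e*c p∤c = split (suc e) c d≡p^1+e*c p∤c
  where
  open ≡-Reasoning
  d≡p^1+e*c : d ≡ p ^ suc e * c
  d≡p^1+e*c = begin
    d                 ≡⟨ m∣n⇒n≡m*quotient p∣d ⟩
    p * quotient p∣d  ≡⟨ cong (p *_) q≡p^e*c ⟩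
    p * (p ^ e * c)   ≡⟨ *-assoc p (p ^ e) c ⟨
    p ^ suc e * c     ∎

powerSplit : ∀ p .{{_ : NonTrivial p}} d .{{_ : NonZero d}} → PowerSplit p d
powerSplit p d = powerSplit-acc p d (<-wellFounded d)

p∣p^1+e*c : ∀ p e c → p ∣ p ^ suc e * c
p∣p^1+e*c p e c = ∣-trans (m∣m*n (p ^ e)) (m∣m*n c)

powerSplit-unique : ∀ {p} .{{_ : NonZero p}} e e′ {c c′} → ¬ p ∣ c → ¬ p ∣ c′ →
  p ^ e * c ≡ p ^ e′ * c′ → e ≡ e′ × c ≡ c′
powerSplit-unique zero zero {c} {c′} _ _ c≡c′ = refl , trans (sym (*-identityˡ c)) (trans c≡c′ (*-identityˡ c′))
powerSplit-unique {p} zero (suc e′) {c} {c′} p∤c _ eq =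
  contradiction (subst (p ∣_) (trans (sym eq) (*-identityˡ c)) (p∣p^1+e*c p e′ c′)) p∤c
powerSplit-unique {p} (suc e) zero {c} {c′} _ p∤c′ eq =
  contradiction (subst (p ∣_) (trans eq (*-identityˡ c′)) (p∣p^1+e*c p e c)) p∤c′
powerSplit-unique {p} (suc e) (suc e′) {c} {c′} p∤c p∤c′ eq
  with e≡e′ , c≡c′ ← powerSplit-unique e e′ p∤c p∤c′
         (*-cancelˡ-≡ (p ^ e * c) (p ^ e′ * c′) p (trans (sym (*-assoc p (p ^ e) c)) (trans eq (*-assoc p (p ^ e′) c′))))
  = cong suc e≡e′ , c≡c′

smooth-mono : y ≤ y′ → Smooth y n → Smooth y′ n
smooth-mono y≤y′ n-smooth p p-prime p∣n = ≤-trans (n-smooth p p-prime p∣n) y≤y′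

smooth-∣ : d ∣ n → Smooth y n → Smooth y d
smooth-∣ d∣n n-smooth p p-prime p∣d = n-smooth p p-prime (∣-trans p∣d d∣n)

smooth-pred : Smooth (suc y) n → ¬ (Prime (suc y) × suc y ∣ n) → Smooth y n
smooth-pred n-smooth ¬[prime∧∣] p p-prime p∣n with m≤n⇒m<n∨m≡n (n-smooth p p-prime p∣n)
... | inj₁ p<1+y = ≤-pred p<1+y
... | inj₂ refl = contradiction (p-prime , p∣n) ¬[prime∧∣]

smooth⇒∤ : Prime l → y < l → Smooth y n → ¬ l ∣ n
smooth⇒∤ l-prime y<l n-smooth l∣n = <⇒≱ y<l (n-smooth _ l-prime l∣n)

self-smooth : ∀ n → Smooth (suc n) (suc n)
self-smooth n p p-prime p∣1+n = ∣⇒≤ p∣1+n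

primorial-flat : y ≤ n → (∀ {j} → y < j → j ≤ n → ¬ Prime j) → primorial n ≡ primorial y
primorial-flat {n = zero} z≤n _ = refl
primorial-flat {y} {suc n} y≤1+n no-prime with m≤n⇒m<n∨m≡n y≤1+n
... | inj₂ refl = refl
... | inj₁ y<1+n with prime? (suc n)
...   | yes 1+n-prime = contradiction 1+n-prime (no-prime y<1+n ≤-refl)
...   | no _ = primorial-flat (≤-pred y<1+n) (λ y<j j≤n → no-prime y<j (m≤n⇒m≤1+n j≤n))

primorial-nextPrime : Prime l → y < l → (∀ {j} → y < j → j < l → ¬ Prime j) →
  primorial l ≡ l * primorial y
primorial-nextPrime {suc l} l-prime y<l no-prime with prime? (suc l)
... | no ¬l-prime = contradiction l-prime ¬l-prime
... | yes _ = cong (suc l *_) (primorial-flat (≤-pred y<l) (λ y<j j≤l → no-prime y<j (s≤s j≤l)))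

module _ {P : Pred ℕ ℓ} (P? : Decidable P) where

  leastWitness-acc : ∀ {n} → Acc _<_ n → P n → ∃[ k ] P k × k ≤ n × (∀ {j} → j < k → ¬ P j)
  leastWitness-acc {n} (acc rs) Pn with anyUpTo? P? n
  ... | no ¬∃j<n = n , Pn , ≤-refl , λ j<n Pj → ¬∃j<n (_ , j<n , Pj)
  ... | yes (j , j<n , Pj) with k , Pk , k≤j , least ← leastWitness-acc (rs j<n) Pj
    = k , Pk , ≤-trans k≤j (<⇒≤ j<n) , least

  leastWitness : P n → ∃[ k ] P k × k ≤ n × (∀ {j} → j < k → ¬ P j)
  leastWitness = leastWitness-acc (<-wellFounded _)

nextPrime : Prime p → y < p → ∃[ l ] Prime l × y < l × l ≤ p × (∀ {j} → y < j → j < l → ¬ Prime j)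
nextPrime {y = y} p-prime y<p with l , (y<l , l-prime) , l≤p , least ← leastWitness (λ j → (y <? j) ×-dec prime? j) (y<p , p-prime)
  = l , l-prime , y<l , l≤p , λ y<j j<l j-prime → least j<l (y<j , j-prime)

record Compression (m y : ℕ) : Set where
  field
    compress : d ∣ m → ℕ
    compress-≤ : (d∣m : d ∣ m) → compress d∣m ≤ d
    compress-nonZero : (d∣m : d ∣ m) → NonZero (compress d∣m)
    compress-smooth : (d∣m : d ∣ m) → Smooth y (compress d∣m)
    compress-injective : ∀ {d d′} (d∣m : d ∣ m) (d′∣m : d′ ∣ m) → compress d∣m ≡ compress d′∣m → d ≡ d′

identityCompression : .{{NonZero m}} → Smooth y m → Compression m y
identityCompression m-smooth = record
  { compress = λ {d} _ → d
  ; compress-≤ = λ _ → ≤-refl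
  ; compress-nonZero = divisor-nonZero
  ; compress-smooth = λ d∣m → smooth-∣ d∣m m-smooth
  ; compress-injective = λ _ _ d≡d′ → d≡d′
  }

compression-mono : y ≤ y′ → Compression m y → Compression m y′
compression-mono y≤y′ C = record
  { Compression C
  ; compress-smooth = λ d∣m → smooth-mono y≤y′ (compress-smooth d∣m)
  }
  where open Compression C

module _ {p l r y : ℕ} (p-prime : Prime p) (l-prime : Prime l) (l≤p : l ≤ p) (y<l : y < l)
         (p∤r : ¬ p ∣ r) (C : Compression r y) (a : ℕ) .{{_ : NonZero (p ^ a * r)}} where

  private
    open module C = Compression C using ()
    instance
      _ = prime⇒nonTrivial p-prime
      _ = prime⇒nonZero l-prime

    cofactor∣r : (S : PowerSplit p d) → d ∣ p ^ a * r → PowerSplit.cofactor S ∣ r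
    cofactor∣r (split e c d≡p^e*c p∤c) d∣m = ∣p^n*r⇒∣r p-prime p∤c a (∣-trans (divides (p ^ e) d≡p^e*c) d∣m)

    -- l ∤ compress c, as compress c is y-smooth and y < l; so l ^ e * compress c determines e
    -- and compress c, which makes this injective.
    compressSplit : PowerSplit p d → d ∣ p ^ a * r → ℕ
    compressSplit S@(split e c _ _) d∣m = l ^ e * C.compress (cofactor∣r S d∣m)

    compressSplit-≤ : (S : PowerSplit p d) (d∣m : d ∣ p ^ a * r) → compressSplit S d∣m ≤ d
    compressSplit-≤ S@(split e c d≡p^e*c _) d∣m =
      ≤-trans (*-mono-≤ (^-monoˡ-≤ e l≤p) (C.compress-≤ (cofactor∣r S d∣m))) (≤-reflexive (sym d≡p^e*c))

    compressSplit-nonZero : (S : PowerSplit p d) (d∣m : d ∣ p ^ a * r) → NonZero (compressSplit S d∣m)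
    compressSplit-nonZero S@(split e c _ _) d∣m =
      m*n≢0 (l ^ e) _ {{m^n≢0 l e}} {{C.compress-nonZero (cofactor∣r S d∣m)}}

    compressSplit-smooth : (S : PowerSplit p d) (d∣m : d ∣ p ^ a * r) → Smooth l (compressSplit S d∣m)
    compressSplit-smooth S@(split e c _ _) d∣m q q-prime q∣l^e*c′
      with euclidsLemma (l ^ e) _ q-prime q∣l^e*c′
    ... | inj₁ q∣l^e = ≤-reflexive (prime∣prime⇒≡ q-prime l-prime (prime∣^⇒prime∣ q-prime e q∣l^e))
    ... | inj₂ q∣c′ = <⇒≤ (≤-<-trans (C.compress-smooth (cofactor∣r S d∣m) q q-prime q∣c′) y<l)

    compressSplit-injective : ∀ {d d′} (S : PowerSplit p d) (S′ : PowerSplit p d′)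
      (d∣m : d ∣ p ^ a * r) (d′∣m : d′ ∣ p ^ a * r) → compressSplit S d∣m ≡ compressSplit S′ d′∣m → d ≡ d′
    compressSplit-injective S@(split e c d≡ _) S′@(split e′ c′ d′≡ _) d∣m d′∣m eq
      with refl , compress-c≡compress-c′ ← powerSplit-unique e e′
             (smooth⇒∤ l-prime y<l (C.compress-smooth (cofactor∣r S d∣m)))
             (smooth⇒∤ l-prime y<l (C.compress-smooth (cofactor∣r S′ d′∣m))) eq
      with refl ← C.compress-injective (cofactor∣r S d∣m) (cofactor∣r S′ d′∣m) compress-c≡compress-c′
      = trans d≡ (sym d′≡)

    splitDivisor : d ∣ p ^ a * r → PowerSplit p d
    splitDivisor {d} d∣m = powerSplit p d {{divisor-nonZero d∣m}}

  extendCompression : Compression (p ^ a * r) l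
  extendCompression = record
    { compress = λ d∣m → compressSplit (splitDivisor d∣m) d∣m
    ; compress-≤ = λ d∣m → compressSplit-≤ (splitDivisor d∣m) d∣m
    ; compress-nonZero = λ d∣m → compressSplit-nonZero (splitDivisor d∣m) d∣m
    ; compress-smooth = λ d∣m → compressSplit-smooth (splitDivisor d∣m) d∣m
    ; compress-injective = λ d∣m d′∣m → compressSplit-injective (splitDivisor d∣m) (splitDivisor d′∣m) d∣m d′∣m
    }

record PrimorialCompression (B m : ℕ) : Set where
  field
    bound : ℕ
    bound≡1⊎prime : bound ≡ 1 ⊎ Prime bound
    bound≤B : bound ≤ B
    primorial-bound≤m : primorial bound ≤ m
    compression : Compression m bound

primorialCompression-mono : ∀ {B B′} → B ≤ B′ → PrimorialCompression B m → PrimorialCompression B′ m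
primorialCompression-mono B≤B′ P = record { PrimorialCompression P ; bound≤B = ≤-trans bound≤B B≤B′ }
  where open PrimorialCompression P

primorialCompression-primePower : ∀ {B} → Prime p → B < p → ¬ p ∣ r → PrimorialCompression B r →
  ∀ a .{{_ : NonZero (p ^ suc a * r)}} → PrimorialCompression p (p ^ suc a * r)
primorialCompression-primePower {p} {r} p-prime B<p p∤r P a
  with l , l-prime , bound<l , l≤p , no-prime-between
         ← nextPrime p-prime (≤-<-trans (PrimorialCompression.bound≤B P) B<p)
  = record
  { bound = l
  ; bound≡1⊎prime = inj₂ l-prime
  ; bound≤B = l≤p
  ; primorial-bound≤m = begin
      primorial l          ≡⟨ primorial-nextPrime l-prime bound<l no-prime-between ⟩
      l * primorial bound  ≤⟨ *-mono-≤ l≤p primorial-bound≤m ⟩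
      p * r                ≤⟨ *-monoʳ-≤ p (m≤n*m r (p ^ a) {{m^n≢0 p a {{prime⇒nonZero p-prime}}}}) ⟩
      p * (p ^ a * r)      ≡⟨ *-assoc p (p ^ a) r ⟨
      p ^ suc a * r        ∎
  ; compression = extendCompression p-prime l-prime l≤p bound<l p∤r compression (suc a)
  }
  where
  open PrimorialCompression P
  open ≤-Reasoning

primorialCompression : ∀ B m .{{_ : NonZero m}} → Smooth (suc B) m → PrimorialCompression (suc B) m
primorialCompression zero m m-smooth = record
  { bound = 1
  ; bound≡1⊎prime = inj₁ refl
  ; bound≤B = ≤-refl
  ; primorial-bound≤m = >-nonZero⁻¹ m
  ; compression = identityCompression m-smooth
  }
primorialCompression (suc B) m m-smooth with prime? (2 + B) ×-dec (2 + B) ∣? m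
... | no ¬[prime∧∣] =
  primorialCompression-mono (n≤1+n _) (primorialCompression B m (smooth-pred m-smooth ¬[prime∧∣]))
... | yes (p-prime , p∣m) with powerSplit (2 + B) m
...   | split zero r refl p∤r = contradiction (subst (_ ∣_) (*-identityˡ r) p∣m) p∤r
...   | split (suc a) r refl p∤r =
  primorialCompression-primePower p-prime ≤-refl p∤r (primorialCompression B r {{r≢0}} r-smooth) a
  where
  r≢0 = m*n≢0⇒n≢0 ((2 + B) ^ suc a)
  r-smooth : Smooth (suc B) r
  r-smooth = smooth-pred (smooth-∣ (divides ((2 + B) ^ suc a) refl) m-smooth) (λ (_ , p∣r) → p∤r p∣r)

divisorsUpTo-≤-Ψ : ∀ z → Compression m y → divisorsUpTo m z ≤ Ψ z y
divisorsUpTo-≤-Ψ {m} {y} z C =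
  length-≤-of-injection _≟_ (filter⁺ (λ k → suc k ∣? m) (upTo⁺ z)) f f-injective f-into
  where
  open Compression C
  divisors = filter (λ k → suc k ∣? m) (upTo z)

  divisor : ∀ {k} → k ∈ divisors → suc k ∣ m
  divisor = proj₂ ∘ ∈-filter⁻ (λ k → suc k ∣? m) {xs = upTo z}

  f : ∀ {k} → k ∈ divisors → ℕ
  f k∈ = pred (compress (divisor k∈))

  f-injective : ∀ {k k′} (k∈ : k ∈ divisors) (k′∈ : k′ ∈ divisors) → f k∈ ≡ f k′∈ → k ≡ k′
  f-injective k∈ k′∈ fk≡fk′ = suc-injective (compress-injective (divisor k∈) (divisor k′∈)
    (pred-injective {{compress-nonZero (divisor k∈)}} {{compress-nonZero (divisor k′∈)}} fk≡fk′))

  f-into : ∀ {k} (k∈ : k ∈ divisors) → f k∈ ∈ filter (smooth? y) (upTo z)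
  f-into {k} k∈ = ∈-filter⁺ (smooth? y) (∈-upTo⁺ (begin
      suc (f k∈)             ≡⟨ suc-pred _ {{compress-nonZero (divisor k∈)}} ⟩
      compress (divisor k∈)  ≤⟨ compress-≤ (divisor k∈) ⟩
      suc k                  ≤⟨ ∈-upTo⁻ (proj₁ (∈-filter⁻ (λ k → suc k ∣? m) {xs = upTo z} k∈)) ⟩
      z                      ∎))
    (subst (Smooth y) (sym (suc-pred _ {{compress-nonZero (divisor k∈)}})) (compress-smooth (divisor k∈)))
    where open ≤-Reasoning

corollary5p5 : (m z q : ℕ) → 2 ≤ m →
    Prime q → primorial q ≤ m → (∀ p → Prime p → primorial p ≤ m → p ≤ q) →
    divisorsUpTo m z ≤ Ψ z q
corollary5p5 m@(suc n) z q (s≤s _) q-prime _ q-maximal =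
  divisorsUpTo-≤-Ψ z (compression-mono bound≤q compression)
  where
  open PrimorialCompression (primorialCompression n m (self-smooth n))
  bound≤q : bound ≤ q
  bound≤q = [ (λ bound≡1 → ≤-trans (≤-reflexive bound≡1) (>-nonZero⁻¹ q {{prime⇒nonZero q-prime}}))
            , (λ bound-prime → q-maximal bound bound-prime primorial-bound≤m)
            ]′ bound≡1⊎prime
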